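{- Let $K$ be a finite set of implicative-disjunctive formulas and $A$ an implicative-disjunctive formula. Suppose that $H \vdash_{id} (J)^{A}$ for all disjoint sets $H, J$ with $H \cup J = K$. Then $\vdash_{id} A$.
   Context: **Language.** Formulas are built from the atomic formulas $p_1, p_2, \dots$ using the binary connectives $\to$ and $\vee$ (implicative-disjunctive formulas). Iterated connectives associate to the right. All formulas are arranged in a fixed decidable linear order $R$. **Notation.** For a finite set $J$ of formulas with distinct elements $B_1, \dots, B_n$ listed in the order $R$, $(J)^{A}$ is $A$ if $J$ is empty, and $B_1 \vee \dots \vee B_n \vee A$ (that is, $B_1 \vee (B_2 \vee (\dots \vee (B_n \vee A)))$) otherwise. **Calculus.** $H \vdash_{id} C$ means that $C$ is derivable from the members of $H$ in the classical implicative-disjunctive propositional calculus; $\vdash_{id} A$ means that $A$ is a thesis. The axiom schemes are: - $A \to B \to A$; - $(A \to B \to C) \to (A \to B) \to A \to C$; - $((A \to B) \to A) \to A$; - $A \to (A \vee B)$; - $A \to (B \vee A)$; - $(A \to C) \to (B \to C) \to (A \vee B) \to C$. Its only rule is modus ponens. -}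

module Defs where

open import Data.Nat using (ℕ)
import Data.Nat as ℕ
open import Data.List using (List; []; _∷_; foldr)
open import Data.List.Membership.Propositional using (_∈_)
open import Relation.Binary.Definitions using (Tri; tri<; tri≈; tri>)
open import Relation.Binary.PropositionalEquality using (_≡_)

infixr 5 _⇒_
infixr 6 _∨_

-- Implicative-disjunctive formulas; the atom p_{i+1} is  var i.
data Formula : Set where
  var : ℕ → Formula
  _⇒_ : Formula → Formula → Formula
  _∨_ : Formula → Formula → Formula

data Ord3 : Set where
  lt eq gt : Ord3

cmpℕ : ℕ → ℕ → Ord3
cmpℕ m n with ℕ.<-cmp m n
... | tri< _ _ _ = lt
... | tri≈ _ _ _ = eq
... | tri> _ _ _ = gt

lex : Ord3 → Ord3 → Ord3
lex lt _ = lt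
lex eq o = o
lex gt _ = gt

cmpR : Formula → Formula → Ord3
cmpR (var m) (var n) = cmpℕ m n
cmpR (var _) (_ ⇒ _) = lt
cmpR (var _) (_ ∨ _) = lt
cmpR (_ ⇒ _) (var _) = gt
cmpR (A ⇒ B) (C ⇒ D) = lex (cmpR A C) (cmpR B D)
cmpR (_ ⇒ _) (_ ∨ _) = lt
cmpR (_ ∨ _) (var _) = gt
cmpR (_ ∨ _) (_ ⇒ _) = gt
cmpR (A ∨ B) (C ∨ D) = lex (cmpR A C) (cmpR B D)

insertR : Formula → List Formula → List Formula
insertR x [] = x ∷ []
insertR x (y ∷ ys) with cmpR x y
... | lt = x ∷ y ∷ ys
... | eq = y ∷ ys
... | gt = y ∷ insertR x ys

sortR : List Formula → List Formula
sortR = foldr insertR []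

disjChain : List Formula → Formula → Formula
disjChain [] A = A
disjChain (B ∷ Bs) A = B ∨ disjChain Bs A

_^^_ : List Formula → Formula → Formula
J ^^ A = disjChain (sortR J) A

infix 3 _⊢id_
data _⊢id_ (H : List Formula) : Formula → Set where
  hyp : ∀ {C} → C ∈ H → H ⊢id C
  ax1 : ∀ {A B} → H ⊢id A ⇒ B ⇒ A
  ax2 : ∀ {A B C} → H ⊢id (A ⇒ B ⇒ C) ⇒ (A ⇒ B) ⇒ A ⇒ C
  ax3 : ∀ {A B} → H ⊢id ((A ⇒ B) ⇒ A) ⇒ A
  ax4 : ∀ {A B} → H ⊢id A ⇒ (A ∨ B)
  ax5 : ∀ {A B} → H ⊢id A ⇒ (B ∨ A)
  ax6 : ∀ {A B C} → H ⊢id (A ⇒ C) ⇒ (B ⇒ C) ⇒ (A ∨ B) ⇒ C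
  mp  : ∀ {A B} → H ⊢id A ⇒ B → H ⊢id A → H ⊢id B

Thesis : Formula → Set
Thesis A = [] ⊢id A

-- Induct on K.  A repeated element of K changes nothing.  For a fresh k, any
-- partition (H , J) of K extends to the partitions (k ∷ H , J) and (H , k ∷ J)
-- of k ∷ K, so H ⊢ k ⇒ J^A by the deduction theorem and H ⊢ k ∨ J^A; the
-- disjunction axiom then gives H ⊢ J^A.  For K = [] the only partition is
-- ([] , []), where the hypothesis is ⊢ A itself.
module Submission where

open import Defs
import Data.Nat.Properties as ℕ
open import Data.Empty using (⊥)
open import Data.Product using (_×_; _,_)
open import Data.Sum using (_⊎_; inj₁; inj₂; [_,_])
import Data.Sum as Sum
open import Data.List using (List; []; _∷_)
open import Data.List.Membership.Propositional using (_∈_; _∉_)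
open import Data.List.Relation.Unary.Any using (here; there)
open import Function.Bundles using (_⇔_; mk⇔; Equivalence)
open import Relation.Binary.Definitions using (tri≈; DecidableEquality)
open import Relation.Binary.PropositionalEquality using (_≡_; refl; cong; cong₂)
open import Relation.Nullary using (yes; no; map′; _×-dec_)

open Equivalence using (to; from)

infix 4 _≟_

⇒-injective : ∀ {A B C D} → A ⇒ B ≡ C ⇒ D → A ≡ C × B ≡ D
⇒-injective refl = refl , refl

∨-injective : ∀ {A B C D} → A ∨ B ≡ C ∨ D → A ≡ C × B ≡ D
∨-injective refl = refl , refl

_≟_ : DecidableEquality Formula
var m ≟ var n = map′ (cong var) (λ { refl → refl }) (m ℕ.≟ n)
A ⇒ B ≟ C ⇒ D =
  map′ (λ (p , q) → cong₂ _⇒_ p q) ⇒-injective ((A ≟ C) ×-dec (B ≟ D))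
A ∨ B ≟ C ∨ D =
  map′ (λ (p , q) → cong₂ _∨_ p q) ∨-injective ((A ≟ C) ×-dec (B ≟ D))
var _ ≟ _ ⇒ _ = no λ ()
var _ ≟ _ ∨ _ = no λ ()
_ ⇒ _ ≟ var _ = no λ ()
_ ⇒ _ ≟ _ ∨ _ = no λ ()
_ ∨ _ ≟ var _ = no λ ()
_ ∨ _ ≟ _ ⇒ _ = no λ ()

open import Data.List.Membership.DecPropositional _≟_ using (_∈?_)

cmpℕ≡eq⇒≡ : ∀ m n → cmpℕ m n ≡ eq → m ≡ n
cmpℕ≡eq⇒≡ m n e with ℕ.<-cmp m n | e
... | tri≈ _ m≡n _ | _ = m≡n

lex≡eq : ∀ o o′ → lex o o′ ≡ eq → o ≡ eq × o′ ≡ eq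
lex≡eq eq _ e = refl , e

cmpR≡eq⇒≡ : ∀ A B → cmpR A B ≡ eq → A ≡ B
cmpR≡eq⇒≡ (var m) (var n) e = cong var (cmpℕ≡eq⇒≡ m n e)
cmpR≡eq⇒≡ (A ⇒ B) (C ⇒ D) e with lex≡eq (cmpR A C) (cmpR B D) e
... | p , q = cong₂ _⇒_ (cmpR≡eq⇒≡ A C p) (cmpR≡eq⇒≡ B D q)
cmpR≡eq⇒≡ (A ∨ B) (C ∨ D) e with lex≡eq (cmpR A C) (cmpR B D) e
... | p , q = cong₂ _∨_ (cmpR≡eq⇒≡ A C p) (cmpR≡eq⇒≡ B D q)

∈-insertR⁻ : ∀ {z} x ys → z ∈ insertR x ys → z ≡ x ⊎ z ∈ ys
∈-insertR⁻ x [] (here z≡x) = inj₁ z≡x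
∈-insertR⁻ x (y ∷ ys) z∈ with cmpR x y | z∈
... | lt | here z≡x = inj₁ z≡x
... | lt | there z∈ys = inj₂ z∈ys
... | eq | z∈ys = inj₂ z∈ys
... | gt | here z≡y = inj₂ (here z≡y)
... | gt | there z∈ins = Sum.map₂ there (∈-insertR⁻ x ys z∈ins)

∈-insertR⁺ˡ : ∀ x ys → x ∈ insertR x ys
∈-insertR⁺ˡ x [] = here refl
∈-insertR⁺ˡ x (y ∷ ys) with cmpR x y in e
... | lt = here refl
... | eq = here (cmpR≡eq⇒≡ x y e)
... | gt = there (∈-insertR⁺ˡ x ys)

∈-insertR⁺ʳ : ∀ {z} x ys → z ∈ ys → z ∈ insertR x ys
∈-insertR⁺ʳ x (y ∷ ys) z∈ with cmpR x y | z∈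
... | lt | _ = there z∈
... | eq | _ = z∈
... | gt | here z≡y = here z≡y
... | gt | there z∈ys = there (∈-insertR⁺ʳ x ys z∈ys)

∈-sortR⁻ : ∀ {z} L → z ∈ sortR L → z ∈ L
∈-sortR⁻ (x ∷ L) z∈ with ∈-insertR⁻ x (sortR L) z∈
... | inj₁ z≡x = here z≡x
... | inj₂ z∈sorted = there (∈-sortR⁻ L z∈sorted)

∈-sortR⁺ : ∀ {z} L → z ∈ L → z ∈ sortR L
∈-sortR⁺ (x ∷ L) (here refl) = ∈-insertR⁺ˡ x (sortR L)
∈-sortR⁺ (x ∷ L) (there z∈L) = ∈-insertR⁺ʳ x (sortR L) (∈-sortR⁺ L z∈L)

⇒-refl : ∀ {H A} → H ⊢id A ⇒ A
⇒-refl {A = A} = mp (mp ax2 ax1) (ax1 {B = A})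

⇒-weaken : ∀ {H A B} → H ⊢id A → H ⊢id B ⇒ A
⇒-weaken = mp ax1

⇒-mp : ∀ {H A B C} → H ⊢id A ⇒ B ⇒ C → H ⊢id A ⇒ B → H ⊢id A ⇒ C
⇒-mp p q = mp (mp ax2 p) q

⇒-trans : ∀ {H A B C} → H ⊢id A ⇒ B → H ⊢id B ⇒ C → H ⊢id A ⇒ C
⇒-trans p q = ⇒-mp (⇒-weaken q) p

deduction : ∀ {H B C} → B ∷ H ⊢id C → H ⊢id B ⇒ C
deduction (hyp (here refl)) = ⇒-refl
deduction (hyp (there C∈H)) = ⇒-weaken (hyp C∈H)
deduction ax1 = ⇒-weaken ax1
deduction ax2 = ⇒-weaken ax2
deduction ax3 = ⇒-weaken ax3
deduction ax4 = ⇒-weaken ax4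
deduction ax5 = ⇒-weaken ax5
deduction ax6 = ⇒-weaken ax6
deduction (mp p q) = ⇒-mp (deduction p) (deduction q)

∨-elim : ∀ {H A B C} → H ⊢id A ⇒ C → H ⊢id B ⇒ C → H ⊢id A ∨ B → H ⊢id C
∨-elim p q r = mp (mp (mp ax6 p) q) r

disjChain-elim : ∀ {H A C} L → H ⊢id A ⇒ C → (∀ {B} → B ∈ L → H ⊢id B ⇒ C) →
                 H ⊢id disjChain L A ⇒ C
disjChain-elim [] a _ = a
disjChain-elim (B ∷ L) a bs =
  mp (mp ax6 (bs (here refl))) (disjChain-elim L a (λ B∈L → bs (there B∈L)))

disjChain-introʳ : ∀ {H A} L → H ⊢id A ⇒ disjChain L A
disjChain-introʳ [] = ⇒-refl
disjChain-introʳ (B ∷ L) = ⇒-trans (disjChain-introʳ L) ax5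

disjChain-introˡ : ∀ {H A B} L → B ∈ L → H ⊢id B ⇒ disjChain L A
disjChain-introˡ (B ∷ L) (here refl) = ax4
disjChain-introˡ (C ∷ L) (there B∈L) = ⇒-trans (disjChain-introˡ L B∈L) ax5

^^-uncons : ∀ {H} k J A → H ⊢id (k ∷ J) ^^ A ⇒ k ∨ J ^^ A
^^-uncons {H} k J A =
  disjChain-elim (sortR (k ∷ J)) (⇒-trans (disjChain-introʳ (sortR J)) ax5) member
  where
  member : ∀ {B} → B ∈ sortR (k ∷ J) → H ⊢id B ⇒ k ∨ J ^^ A
  member B∈ with ∈-sortR⁻ (k ∷ J) B∈
  ... | here refl = ax4
  ... | there B∈J = ⇒-trans (disjChain-introˡ (sortR J) (∈-sortR⁺ J B∈J)) ax5

Disjoint : List Formula → List Formula → Set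
Disjoint H J = ∀ x → x ∈ H → x ∈ J → ⊥

Covers : List Formula → List Formula → List Formula → Set
Covers K H J = ∀ x → x ∈ K ⇔ (x ∈ H ⊎ x ∈ J)

EverySplit⊢ : List Formula → Formula → Set
EverySplit⊢ K A = ∀ H J → Disjoint H J → Covers K H J → H ⊢id J ^^ A

disjoint-∷ˡ : ∀ {k H J} → k ∉ J → Disjoint H J → Disjoint (k ∷ H) J
disjoint-∷ˡ k∉J _ x (here refl) = k∉J
disjoint-∷ˡ _ H#J x (there x∈H) = H#J x x∈H

disjoint-∷ʳ : ∀ {k H J} → k ∉ H → Disjoint H J → Disjoint H (k ∷ J)
disjoint-∷ʳ k∉H _ x x∈H (here refl) = k∉H x∈H
disjoint-∷ʳ _ H#J x x∈H (there x∈J) = H#J x x∈H x∈J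

covers-∷ˡ : ∀ {k K H J} → Covers K H J → Covers (k ∷ K) (k ∷ H) J
covers-∷ˡ cov x = mk⇔
  (λ { (here refl) → inj₁ (here refl) ; (there x∈K) → Sum.map₁ there (to (cov x) x∈K) })
  (λ { (inj₁ (here refl)) → here refl
     ; (inj₁ (there x∈H)) → there (from (cov x) (inj₁ x∈H))
     ; (inj₂ x∈J) → there (from (cov x) (inj₂ x∈J)) })

covers-∷ʳ : ∀ {k K H J} → Covers K H J → Covers (k ∷ K) H (k ∷ J)
covers-∷ʳ cov x = mk⇔
  (λ { (here refl) → inj₂ (here refl) ; (there x∈K) → Sum.map₂ there (to (cov x) x∈K) })
  (λ { (inj₂ (here refl)) → here refl
     ; (inj₂ (there x∈J)) → there (from (cov x) (inj₂ x∈J))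
     ; (inj₁ x∈H) → there (from (cov x) (inj₁ x∈H)) })

covers-∷-duplicate : ∀ {k K H J} → k ∈ K → Covers K H J → Covers (k ∷ K) H J
covers-∷-duplicate k∈K cov x = mk⇔
  (λ { (here refl) → to (cov x) k∈K ; (there x∈K) → to (cov x) x∈K })
  (λ x∈H⊎J → there (from (cov x) x∈H⊎J))

everySplit⊢-[] : ∀ {A} → EverySplit⊢ [] A → Thesis A
everySplit⊢-[] P = P [] [] (λ _ ()) (λ _ → mk⇔ (λ ()) [ (λ ()) , (λ ()) ])

everySplit⊢-duplicate : ∀ {k K A} → k ∈ K → EverySplit⊢ (k ∷ K) A → EverySplit⊢ K A
everySplit⊢-duplicate k∈K P H J H#J cov = P H J H#J (covers-∷-duplicate k∈K cov)

everySplit⊢-fresh : ∀ {k K A} → k ∉ K → EverySplit⊢ (k ∷ K) A → EverySplit⊢ K A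
everySplit⊢-fresh {k} {K} {A} k∉K P H J H#J cov =
  ∨-elim k⇒J^A ⇒-refl (mp (^^-uncons k J A) [k∷J]^A)
  where
  k⇒J^A : H ⊢id k ⇒ J ^^ A
  k⇒J^A = deduction (P (k ∷ H) J
    (disjoint-∷ˡ (λ k∈J → k∉K (from (cov k) (inj₂ k∈J))) H#J) (covers-∷ˡ cov))
  [k∷J]^A : H ⊢id (k ∷ J) ^^ A
  [k∷J]^A = P H (k ∷ J)
    (disjoint-∷ʳ (λ k∈H → k∉K (from (cov k) (inj₁ k∈H))) H#J) (covers-∷ʳ cov)

everySplit⊢-∷ : ∀ {k K A} → EverySplit⊢ (k ∷ K) A → EverySplit⊢ K A
everySplit⊢-∷ {k} {K} with k ∈? K
... | yes k∈K = everySplit⊢-duplicate k∈K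
... | no k∉K = everySplit⊢-fresh k∉K

mainTheorem11 : (K : List Formula) (A : Formula) →
    ((H J : List Formula) →
      (∀ x → x ∈ H → x ∈ J → ⊥) →
      (∀ x → x ∈ K ⇔ (x ∈ H ⊎ x ∈ J)) →
      H ⊢id (J ^^ A)) →
    Thesis A
mainTheorem11 [] A P = everySplit⊢-[] P
mainTheorem11 (k ∷ K) A P = mainTheorem11 K A (everySplit⊢-∷ P)
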